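{- Let $n\ge 3$ and $m\ge 3$ be integers, let $a\in\mathbb{Z}_n$ have additive order greater than $3$, and let $i$ be an integer with $\gcd(i,m)=1$. Then the Cayley graph $\mathrm{Cay}(\mathbb{Z}_n\times\mathbb{Z}_m,\ \pm\{0,a,2a\}\times\{\pm i\})$ admits a $C_m$-factorization.
   Context: For a finite additive group $\Gamma$ and $S\subseteq\Gamma\setminus\{0\}$ with $S=-S$, the Cayley graph $\mathrm{Cay}(\Gamma,S)$ has vertex set $\Gamma$ and edges $\{a,b\}$ with $a-b\in S$. Here $\pm\{0,a,2a\}\times\{\pm i\}$ denotes the set $\{(x,y): x\in\{0,a,-a,2a,-2a\},\ y\in\{i,-i\}\}\subseteq \mathbb{Z}_n\times\mathbb{Z}_m$. A $C_m$-factor of a graph is a spanning subgraph all of whose components are cycles of length $m$; a $C_m$-factorization is a partition of the edge set into $C_m$-factors. -}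

module Defs where

open import Data.Nat using (ℕ; zero; suc; _+_; _*_; _∸_)
open import Data.Fin using (Fin; toℕ)
open import Data.Nat.DivMod using (_mod_)
open import Data.Integer using (ℤ; +_)
import Data.Integer as ℤ
open import Data.Integer.Divisibility renaming (_∣_ to _∣ℤ_)
open import Data.Product using (Σ; ∃; ∃-syntax; _×_; _,_)
open import Data.Sum using (_⊎_)
open import Relation.Binary.PropositionalEquality using (_≡_)
open import Function.Definitions using (Injective)

-- (the zero of Z_n is written 0 · x below, = 0 mod n)

_⊕_ : ∀ {n} → Fin n → Fin n → Fin n
_⊕_ {suc k} x y = (toℕ x + toℕ y) mod suc k

⊖_ : ∀ {n} → Fin n → Fin n
⊖_ {suc k} x = (suc k ∸ toℕ x) mod suc k

_⊝_ : ∀ {n} → Fin n → Fin n → Fin n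
x ⊝ y = x ⊕ (⊖ y)

_·_ : ∀ {n} → ℕ → Fin n → Fin n
_·_ {suc k} c x = (c * toℕ x) mod suc k

_≡ℤ_ : ∀ {m} → Fin m → ℤ → Set
_≡ℤ_ {m} y z = (+ m) ∣ℤ ((+ toℕ y) ℤ.- z)

OrderGT3 : ∀ {n} → Fin n → Set
OrderGT3 a = (1 · a ≡ 0 · a → ⊥') × (2 · a ≡ 0 · a → ⊥') × (3 · a ≡ 0 · a → ⊥')
  where open import Data.Empty renaming (⊥ to ⊥')

Vertex : ℕ → ℕ → Set
Vertex n m = Fin n × Fin m

CayAdj : ∀ {n m} → (Vertex n m → Set) → Vertex n m → Vertex n m → Set
CayAdj S (u₁ , u₂) (v₁ , v₂) = S (u₁ ⊝ v₁ , u₂ ⊝ v₂)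

Sₐᵢ : ∀ {n m} → Fin n → ℤ → Vertex n m → Set
Sₐᵢ {n} a i (x , y) =
  ((x ≡ (0 · a)) ⊎ (x ≡ a) ⊎ (x ≡ ⊖ a) ⊎ (x ≡ 2 · a) ⊎ (x ≡ ⊖ (2 · a)))
  × ((y ≡ℤ i) ⊎ (y ≡ℤ (ℤ.- i)))

next : ∀ {m} → Fin m → Fin m
next {suc k} j = suc (toℕ j) mod suc k

-- A C_m-factor: a spanning subgraph whose components are cycles of
-- length m, given by its list of components.  The edges of the factor are
-- exactly the cycle edges.
record CFactor (V : Set) (Adj : V → V → Set) (m : ℕ) : Set where
  field
    k        : ℕ
    cyc      : Fin k → Fin m → V
    cyc-inj  : ∀ c → Injective _≡_ _≡_ (cyc c)
    cyc-adj  : ∀ c j → Adj (cyc c j) (cyc c (next j))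
    covers   : ∀ v → ∃[ c ] ∃[ j ] (cyc c j ≡ v)
    disjoint : ∀ c c' j j' → cyc c j ≡ cyc c' j' → c ≡ c'

InFactor : ∀ {V Adj m} → CFactor V Adj m → V → V → Set
InFactor F u v =
  ∃[ c ] ∃[ j ] ((cyc c j ≡ u × cyc c (next j) ≡ v)
               ⊎ (cyc c j ≡ v × cyc c (next j) ≡ u))
  where open CFactor F

-- A C_m-factorization: a family of C_m-factors partitioning the edge set
-- (every edge lies in exactly one factor; factor edges are graph edges
-- by cyc-adj).
record CFactorization (V : Set) (Adj : V → V → Set) (m : ℕ) : Set where
  field
    r       : ℕ
    factor  : Fin r → CFactor V Adj m
    cover   : ∀ u v → Adj u v → ∃[ f ] InFactor (factor f) u v
    unique  : ∀ u v → Adj u v → ∀ f f' →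
              InFactor (factor f) u v → InFactor (factor f') u v → f ≡ f'

-- Since gcd(i, m) = 1, j ↦ j·i enumerates ℤ_m, so the vertex set splits into m levels and
-- every edge joins two consecutive levels, its ℤ_n-difference lying in D = ±{0,a,2a}.  A
-- C_m-factor whose cycles move up one level at each step is a family of permutations of ℤ_n,
-- one per pair of consecutive levels, each shifting by elements of D; r such factors form a
-- factorization as soon as, at every level and every vertex, the r factors leave the vertex
-- through all the |D| = r differences (r = 5, or r = 4 when 4a = 0 and 2a = −2a): uniqueness
-- then follows by pigeonhole.
--
-- The factors are translates of finitely many offsets: the cycle of factor f through c sits
-- at c + t·a on level j, with t read from a table indexed by f and by the phase of j, a
-- periodic pattern of four phases that closes up for every m ≥ 3.  All conditions become
-- finitely many arithmetic checks on the tables, decided by evaluation.  When 4a = 0 and m is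
-- odd no table of this kind exists, because each step contributes 0 + 1 + 2 + 3 ≡ 2 (mod 4) to
-- the total offset of the r cycles; there the offsets also depend on a 2-colouring of ℤ_n that
-- flips under x ↦ x + a, the parity of ⌊4x/n⌋.

module Submission where

open import Defs
open import Level using (0ℓ)
open import Algebra.Bundles using (AbelianGroup)
open import Data.Empty using (⊥; ⊥-elim)
open import Data.Fin as Fin using (Fin; toℕ; fromℕ<)
open import Data.Fin.Patterns using (0F; 1F; 2F; 3F; 4F)
open import Data.Fin.Properties
  using (toℕ-injective; toℕ<n; toℕ≤pred[n]; toℕ-fromℕ<; any?; all?; injective⇒≤; punchOut-injective)
open import Data.Integer as ℤ using (ℤ; +_)
import Data.Integer.Properties as ℤ
open import Data.Integer.DivMod using (_%ℕ_; _/ℕ_; n%ℕd<d; a≡a%ℕn+[a/ℕn]*n)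
import Data.Integer.Divisibility.Signed as ℤ∣
open import Data.Integer.GCD using (gcd)
open import Data.Integer.Tactic.RingSolver using (solve-∀)
open import Data.Nat as ℕ using (ℕ; zero; suc; _+_; _*_; _∸_; _≤_; _<_; _≥_; z≤n; s≤s; parity)
open import Data.Nat.Coprimality using (Coprime; coprime-divisor; gcd≡1⇒coprime)
open import Data.Nat.DivMod
open import Data.Nat.Divisibility using (divides; >⇒∤; m%n≡0⇒n∣m) renaming (_∣_ to _∣ℕ_)
open import Data.Nat.Properties
open import Data.Parity.Base as ℙ using (Parity; 0ℙ; 1ℙ)
import Data.Parity.Properties as ℙ
open import Data.Product using (∃-syntax; _,_; proj₁; proj₂)
open import Data.Sum using (_⊎_; inj₁; inj₂)
open import Data.Vec using ([]; _∷_; lookup)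
open import Function.Definitions using (Injective)
open import Relation.Nullary using (Dec; yes; no)
open import Relation.Nullary.Decidable using (map′; _×-dec_; _→-dec_; from-yes)
open import Relation.Binary.PropositionalEquality
  using (_≡_; _≢_; refl; sym; trans; cong; cong₂; subst; subst₂; isEquivalence; module ≡-Reasoning)

-- Differences in abelian groups; maps between finite sets

module AbelianGroupDifferences {c ℓ} (G : AbelianGroup c ℓ) where

  open AbelianGroup G renaming (trans to ≈-trans; sym to ≈-sym)
  open import Algebra.Properties.AbelianGroup G
  open import Relation.Binary.Reasoning.Setoid setoid

  [x-y]∙[y∙z]≈x∙z : ∀ x y z → (x - y) ∙ (y ∙ z) ≈ x ∙ z
  [x-y]∙[y∙z]≈x∙z x y z = ≈-trans (assoc x (y ⁻¹) (y ∙ z)) (∙-congˡ (\\-leftDividesʳ y z))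

  x∙w≈z∙y⇒x-y≈z-w : ∀ x y z w → x ∙ w ≈ z ∙ y → x - y ≈ z - w
  x∙w≈z∙y⇒x-y≈z-w x y z w eq = ∙-cancelʳ (y ∙ w) (x - y) (z - w) (begin
    (x - y) ∙ (y ∙ w)  ≈⟨ [x-y]∙[y∙z]≈x∙z x y w ⟩
    x ∙ w              ≈⟨ eq ⟩
    z ∙ y              ≈⟨ [x-y]∙[y∙z]≈x∙z z w y ⟨
    (z - w) ∙ (w ∙ y)  ≈⟨ ∙-congˡ (comm w y) ⟩
    (z - w) ∙ (y ∙ w)  ∎)

  x-y≈z-w⇒x∙w≈z∙y : ∀ x y z w → x - y ≈ z - w → x ∙ w ≈ z ∙ y
  x-y≈z-w⇒x∙w≈z∙y x y z w eq = begin
    x ∙ w              ≈⟨ [x-y]∙[y∙z]≈x∙z x y w ⟨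
    (x - y) ∙ (y ∙ w)  ≈⟨ ∙-congʳ eq ⟩
    (z - w) ∙ (y ∙ w)  ≈⟨ ∙-congˡ (comm y w) ⟩
    (z - w) ∙ (w ∙ y)  ≈⟨ [x-y]∙[y∙z]≈x∙z z w y ⟩
    z ∙ y              ∎

  x∙y-x∙z≈y-z : ∀ x y z → (x ∙ y) - (x ∙ z) ≈ y - z
  x∙y-x∙z≈y-z x y z = x∙w≈z∙y⇒x-y≈z-w (x ∙ y) (x ∙ z) y z (begin
    (x ∙ y) ∙ z  ≈⟨ ∙-congʳ (comm x y) ⟩
    (y ∙ x) ∙ z  ≈⟨ assoc y x z ⟩
    y ∙ (x ∙ z)  ∎)

  [x-y]∙z≈x∙[z-y] : ∀ x y z → (x - y) ∙ z ≈ x ∙ (z - y)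
  [x-y]∙z≈x∙[z-y] x y z = ≈-trans (assoc x (y ⁻¹) z) (∙-congˡ (comm (y ⁻¹) z))

  x∙[y-x]≈y : ∀ x y → x ∙ (y - x) ≈ y
  x∙[y-x]≈y x y = ≈-trans (comm x (y - x)) (//-rightDividesˡ x y)

  x-ε≈x : ∀ x → x - ε ≈ x
  x-ε≈x x = ≈-trans (∙-congˡ ε⁻¹≈ε) (identityʳ x)

  ε-x≈x⁻¹ : ∀ x → ε - x ≈ x ⁻¹
  ε-x≈x⁻¹ x = identityˡ (x ⁻¹)

  x-[x∙y]≈y⁻¹ : ∀ x y → x - (x ∙ y) ≈ y ⁻¹
  x-[x∙y]≈y⁻¹ x y =
    ≈-trans (x∙w≈z∙y⇒x-y≈z-w x (x ∙ y) ε y (≈-sym (identityˡ (x ∙ y)))) (ε-x≈x⁻¹ y)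

  x-y≈z⇒x≈y∙z : ∀ x y z → x - y ≈ z → x ≈ y ∙ z
  x-y≈z⇒x≈y∙z x y z eq = begin
    x            ≈⟨ //-rightDividesˡ y x ⟨
    (x - y) ∙ y  ≈⟨ ∙-congʳ eq ⟩
    z ∙ y        ≈⟨ comm z y ⟩
    y ∙ z        ∎

injective⇒surjective : ∀ {n} {f : Fin n → Fin n} → Injective _≡_ _≡_ f → ∀ y → ∃[ x ] f x ≡ y
injective⇒surjective {suc n} {f} f-inj y with any? (λ x → f x Fin.≟ y)
... | yes hit = hit
... | no miss = ⊥-elim (1+n≰n (injective⇒≤ g-inj))
  where
  y≢f : ∀ x → y ≢ f x
  y≢f x e = miss (x , sym e)
  g : Fin (suc n) → Fin n
  g x = Fin.punchOut (y≢f x)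
  g-inj : Injective _≡_ _≡_ g
  g-inj {x} {x'} e = f-inj (punchOut-injective (y≢f x) (y≢f x') e)

covering⇒injective : ∀ {r} {A : Set} (g w : Fin r → A) → Injective _≡_ _≡_ w →
                     (∀ δ → ∃[ f ] g f ≡ w δ) → Injective _≡_ _≡_ g
covering⇒injective g w w-inj cover {f} {f'} gf≡gf' = begin
  f        ≡⟨ proj₂ (σ-onto f) ⟨
  σ δ      ≡⟨ cong σ (w-inj (begin
    w δ        ≡⟨ proj₂ (cover δ) ⟨
    g (σ δ)    ≡⟨ cong g (proj₂ (σ-onto f)) ⟩
    g f        ≡⟨ gf≡gf' ⟩
    g f'       ≡⟨ cong g (proj₂ (σ-onto f')) ⟨
    g (σ δ')   ≡⟨ proj₂ (cover δ') ⟩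
    w δ'       ∎)) ⟩
  σ δ'     ≡⟨ proj₂ (σ-onto f') ⟩
  f'       ∎
  where
  open ≡-Reasoning
  σ : Fin _ → Fin _
  σ δ = proj₁ (cover δ)
  σ-onto : ∀ f → ∃[ δ ] σ δ ≡ f
  σ-onto = injective⇒surjective {f = σ} λ {δ} {δ'} e →
    w-inj (trans (sym (proj₂ (cover δ))) (trans (cong g e) (proj₂ (cover δ'))))
  δ δ' : Fin _
  δ = proj₁ (σ-onto f)
  δ' = proj₁ (σ-onto f')

-- The cyclic group ℤ/N and multiples of one element

module ZMod (k : ℕ) where

  N : ℕ
  N = suc k

  ⟦_⟧ : ℕ → Fin N
  ⟦ u ⟧ = u mod N

  toℕ-⟦⟧ : ∀ u → toℕ ⟦ u ⟧ ≡ u % N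
  toℕ-⟦⟧ u = toℕ-fromℕ< (m%n<n u N)

  ⟦toℕ⟧ : ∀ x → ⟦ toℕ x ⟧ ≡ x
  ⟦toℕ⟧ x = toℕ-injective (trans (toℕ-⟦⟧ (toℕ x)) (m<n⇒m%n≡m (toℕ<n x)))

  ⟦⟧-≡ : ∀ u v → u % N ≡ v % N → ⟦ u ⟧ ≡ ⟦ v ⟧
  ⟦⟧-≡ u v e = toℕ-injective (trans (toℕ-⟦⟧ u) (trans e (sym (toℕ-⟦⟧ v))))

  ⟦⟧-≡⁻¹ : ∀ u v → ⟦ u ⟧ ≡ ⟦ v ⟧ → u % N ≡ v % N
  ⟦⟧-≡⁻¹ u v e = trans (sym (toℕ-⟦⟧ u)) (trans (cong toℕ e) (toℕ-⟦⟧ v))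

  ⟦⟧-+ : ∀ u v → ⟦ u ⟧ ⊕ ⟦ v ⟧ ≡ ⟦ u + v ⟧
  ⟦⟧-+ u v = begin
    ⟦ toℕ ⟦ u ⟧ + toℕ ⟦ v ⟧ ⟧ ≡⟨ cong₂ (λ s t → ⟦ s + t ⟧) (toℕ-⟦⟧ u) (toℕ-⟦⟧ v) ⟩
    ⟦ u % N + v % N ⟧         ≡⟨ ⟦⟧-≡ (u % N + v % N) (u + v) (sym (%-distribˡ-+ u v N)) ⟩
    ⟦ u + v ⟧                 ∎
    where open ≡-Reasoning

  ⟦⟧-* : ∀ s u → s · ⟦ u ⟧ ≡ ⟦ s * u ⟧
  ⟦⟧-* s u = begin
    ⟦ s * toℕ ⟦ u ⟧ ⟧ ≡⟨ cong (λ t → ⟦ s * t ⟧) (toℕ-⟦⟧ u) ⟩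
    ⟦ s * (u % N) ⟧   ≡⟨ ⟦⟧-≡ (s * (u % N)) (s * u) (begin
        (s * (u % N)) % N           ≡⟨ %-distribˡ-* s (u % N) N ⟩
        (s % N * (u % N % N)) % N   ≡⟨ cong (λ t → (s % N * t) % N) (m%n%n≡m%n u N) ⟩
        (s % N * (u % N)) % N       ≡⟨ %-distribˡ-* s u N ⟨
        (s * u) % N                 ∎) ⟩
    ⟦ s * u ⟧         ∎
    where open ≡-Reasoning

  ⊕-comm : ∀ x y → x ⊕ y ≡ y ⊕ x
  ⊕-comm x y = cong ⟦_⟧ (+-comm (toℕ x) (toℕ y))

  ⊕-assoc : ∀ x y z → (x ⊕ y) ⊕ z ≡ x ⊕ (y ⊕ z)
  ⊕-assoc x y z = begin
    ⟦ X + Y ⟧ ⊕ z       ≡⟨ cong (⟦ X + Y ⟧ ⊕_) (⟦toℕ⟧ z) ⟨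
    ⟦ X + Y ⟧ ⊕ ⟦ Z ⟧   ≡⟨ ⟦⟧-+ (X + Y) Z ⟩
    ⟦ X + Y + Z ⟧       ≡⟨ cong ⟦_⟧ (+-assoc X Y Z) ⟩
    ⟦ X + (Y + Z) ⟧     ≡⟨ ⟦⟧-+ X (Y + Z) ⟨
    ⟦ X ⟧ ⊕ ⟦ Y + Z ⟧   ≡⟨ cong (_⊕ ⟦ Y + Z ⟧) (⟦toℕ⟧ x) ⟩
    x ⊕ (y ⊕ z)         ∎
    where
    open ≡-Reasoning
    X Y Z : ℕ
    X = toℕ x
    Y = toℕ y
    Z = toℕ z

  ⊕-identityˡ : ∀ x → Fin.zero ⊕ x ≡ x
  ⊕-identityˡ = ⟦toℕ⟧

  ⊕-identityʳ : ∀ x → x ⊕ Fin.zero ≡ x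
  ⊕-identityʳ x = trans (⊕-comm x Fin.zero) (⊕-identityˡ x)

  ⊕-inverseʳ : ∀ x → x ⊕ (⊖ x) ≡ Fin.zero
  ⊕-inverseʳ x = begin
    x ⊕ (⊖ x)                   ≡⟨ cong (_⊕ (⊖ x)) (⟦toℕ⟧ x) ⟨
    ⟦ toℕ x ⟧ ⊕ ⟦ N ∸ toℕ x ⟧   ≡⟨ ⟦⟧-+ (toℕ x) (N ∸ toℕ x) ⟩
    ⟦ toℕ x + (N ∸ toℕ x) ⟧     ≡⟨ cong ⟦_⟧ (m+[n∸m]≡n (<⇒≤ (toℕ<n x))) ⟩
    ⟦ N ⟧                       ≡⟨ ⟦⟧-≡ N 0 (n%n≡0 N) ⟩
    Fin.zero                    ∎
    where open ≡-Reasoning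

  ℤ/N : AbelianGroup 0ℓ 0ℓ
  ℤ/N = record
    { Carrier = Fin N
    ; _≈_ = _≡_
    ; _∙_ = _⊕_
    ; ε = Fin.zero
    ; _⁻¹ = ⊖_
    ; isAbelianGroup = record
      { isGroup = record
        { isMonoid = record
          { isSemigroup = record
            { isMagma = record { isEquivalence = isEquivalence ; ∙-cong = cong₂ _⊕_ }
            ; assoc = ⊕-assoc }
          ; identity = ⊕-identityˡ , ⊕-identityʳ }
        ; inverse = (λ x → trans (⊕-comm (⊖ x) x) (⊕-inverseʳ x)) , ⊕-inverseʳ
        ; ⁻¹-cong = cong ⊖_ }
      ; comm = ⊕-comm }
    }

  ·-distribʳ-+ : ∀ s t x → (s + t) · x ≡ (s · x) ⊕ (t · x)
  ·-distribʳ-+ s t x =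
    trans (cong ⟦_⟧ (*-distribʳ-+ (toℕ x) s t)) (sym (⟦⟧-+ (s * toℕ x) (t * toℕ x)))

  ·-assoc : ∀ s t x → (s * t) · x ≡ s · (t · x)
  ·-assoc s t x = trans (cong ⟦_⟧ (*-assoc s t (toℕ x))) (sym (⟦⟧-* s (t * toℕ x)))

  1· : ∀ x → 1 · x ≡ x
  1· x = trans (cong ⟦_⟧ (*-identityˡ (toℕ x))) (⟦toℕ⟧ x)

  ·-zeroʳ : ∀ s → s · Fin.zero ≡ Fin.zero
  ·-zeroʳ s = cong ⟦_⟧ (*-zeroʳ s)

  N·≡zero : ∀ x → N · x ≡ Fin.zero
  N·≡zero x = ⟦⟧-≡ (N * toℕ x) 0 (trans (cong (_% N) (*-comm N (toℕ x))) (m*n%n≡0 (toℕ x) N))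

Dₐ : ∀ {n} → Fin n → Fin n → Set
Dₐ a x = (x ≡ 0 · a) ⊎ (x ≡ a) ⊎ (x ≡ ⊖ a) ⊎ (x ≡ 2 · a) ⊎ (x ≡ ⊖ (2 · a))

-- The δ-th element of Dₐ a, in the order above, is (D-plus δ · a) ⊝ (D-minus δ · a).
D-plus D-minus : Fin 5 → ℕ
D-plus  = lookup (0 ∷ 1 ∷ 0 ∷ 2 ∷ 0 ∷ [])
D-minus = lookup (0 ∷ 0 ∷ 1 ∷ 0 ∷ 2 ∷ [])

module Multiples {k : ℕ} (a : Fin (suc k)) where

  open ZMod k
  open AbelianGroup ℤ/N using (∙-congˡ; ∙-congʳ)
  open import Algebra.Properties.AbelianGroup ℤ/N
    using (identityʳ-unique; ⁻¹-involutive; ⁻¹-anti-homo‿-; ε⁻¹≈ε)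
  open AbelianGroupDifferences ℤ/N
  open ≡-Reasoning

  ·-difference : ∀ s t p q → (s + q) · a ≡ (p + t) · a → (s · a) ⊝ (t · a) ≡ (p · a) ⊝ (q · a)
  ·-difference s t p q eq = x∙w≈z∙y⇒x-y≈z-w (s · a) (t · a) (p · a) (q · a) (begin
    (s · a) ⊕ (q · a)  ≡⟨ ·-distribʳ-+ s q a ⟨
    (s + q) · a        ≡⟨ eq ⟩
    (p + t) · a        ≡⟨ ·-distribʳ-+ p t a ⟩
    (p · a) ⊕ (t · a)  ∎)

  ·-difference⁻¹ : ∀ s t p q → (s · a) ⊝ (t · a) ≡ (p · a) ⊝ (q · a) → (s + q) · a ≡ (p + t) · a
  ·-difference⁻¹ s t p q eq = begin
    (s + q) · a        ≡⟨ ·-distribʳ-+ s q a ⟩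
    (s · a) ⊕ (q · a)  ≡⟨ x-y≈z-w⇒x∙w≈z∙y (s · a) (t · a) (p · a) (q · a) eq ⟩
    (p · a) ⊕ (t · a)  ≡⟨ ·-distribʳ-+ p t a ⟨
    (p + t) · a        ∎

  OrderAbove : ℕ → Set
  OrderAbove B = ∀ K → K ≤ B → K · a ≡ Fin.zero → K ≡ 0

  ·-injective-ordered : ∀ {B u v} → OrderAbove B → v ≤ u → u ≤ B → u · a ≡ v · a → u ≡ v
  ·-injective-ordered {B} {u} {v} order v≤u u≤B eq =
    ≤-antisym (m∸n≡0⇒m≤n (order (u ∸ v) (≤-trans (m∸n≤m u v) u≤B) gap·a≡0)) v≤u
    where
    gap·a≡0 : (u ∸ v) · a ≡ Fin.zero
    gap·a≡0 = identityʳ-unique (v · a) ((u ∸ v) · a) (begin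
      (v · a) ⊕ ((u ∸ v) · a)  ≡⟨ ·-distribʳ-+ v (u ∸ v) a ⟨
      (v + (u ∸ v)) · a        ≡⟨ cong (_· a) (m+[n∸m]≡n v≤u) ⟩
      u · a                    ≡⟨ eq ⟩
      v · a                    ∎)

  ·-injective-≤ : ∀ {B u v} → OrderAbove B → u ≤ B → v ≤ B → u · a ≡ v · a → u ≡ v
  ·-injective-≤ {u = u} {v} order u≤B v≤B eq with ≤-total u v
  ... | inj₁ u≤v = sym (·-injective-ordered order u≤v v≤B (sym eq))
  ... | inj₂ v≤u = ·-injective-ordered order v≤u u≤B eq

  OrderAbove-suc : ∀ {B} → OrderAbove B → suc B · a ≢ Fin.zero → OrderAbove (suc B)
  OrderAbove-suc order [1+B]·a≢0 K K≤1+B K·a≡0 with m≤n⇒m<n∨m≡n K≤1+B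
  ... | inj₁ K<1+B = order K (≤-pred K<1+B) K·a≡0
  ... | inj₂ refl  = ⊥-elim ([1+B]·a≢0 K·a≡0)

  ·-mod : ∀ Q .{{_ : ℕ.NonZero Q}} → Q · a ≡ Fin.zero → ∀ u → (u % Q) · a ≡ u · a
  ·-mod Q Q·a≡0 u = sym (begin
    u · a                                ≡⟨ cong (_· a) (m≡m%n+[m/n]*n u Q) ⟩
    (u % Q + u / Q * Q) · a              ≡⟨ ·-distribʳ-+ (u % Q) (u / Q * Q) a ⟩
    ((u % Q) · a) ⊕ ((u / Q * Q) · a)    ≡⟨ cong (((u % Q) · a) ⊕_) (·-assoc (u / Q) Q a) ⟩
    ((u % Q) · a) ⊕ ((u / Q) · (Q · a))  ≡⟨ cong (λ x → ((u % Q) · a) ⊕ ((u / Q) · x)) Q·a≡0 ⟩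
    ((u % Q) · a) ⊕ ((u / Q) · Fin.zero) ≡⟨ cong (((u % Q) · a) ⊕_) (·-zeroʳ (u / Q)) ⟩
    ((u % Q) · a) ⊕ Fin.zero             ≡⟨ ⊕-identityʳ ((u % Q) · a) ⟩
    (u % Q) · a                          ∎)

  ·⊝0· : ∀ t → (t · a) ⊝ (0 · a) ≡ t · a
  ·⊝0· t = x-ε≈x (t · a)

  0·⊝· : ∀ t → (0 · a) ⊝ (t · a) ≡ ⊖ (t · a)
  0·⊝· t = ε-x≈x⁻¹ (t · a)

  Dₐ-⊖ : ∀ {d} → Dₐ a d → Dₐ a (⊖ d)
  Dₐ-⊖ (inj₁ refl) = inj₁ ε⁻¹≈ε
  Dₐ-⊖ (inj₂ (inj₁ refl)) = inj₂ (inj₂ (inj₁ refl))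
  Dₐ-⊖ (inj₂ (inj₂ (inj₁ refl))) = inj₂ (inj₁ (⁻¹-involutive a))
  Dₐ-⊖ (inj₂ (inj₂ (inj₂ (inj₁ refl)))) = inj₂ (inj₂ (inj₂ (inj₂ refl)))
  Dₐ-⊖ (inj₂ (inj₂ (inj₂ (inj₂ refl)))) = inj₂ (inj₂ (inj₂ (inj₁ (⁻¹-involutive (2 · a)))))

  Dₐ-⊝-swap : ∀ x y → Dₐ a (x ⊝ y) → Dₐ a (y ⊝ x)
  Dₐ-⊝-swap x y d = subst (Dₐ a) (⁻¹-anti-homo‿- x y) (Dₐ-⊖ d)

  D-code : Fin 5 → Fin (suc k)
  D-code δ = (D-plus δ · a) ⊝ (D-minus δ · a)

  D-code-sound : ∀ δ → Dₐ a (D-code δ)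
  D-code-sound 0F = inj₁ (·⊝0· 0)
  D-code-sound 1F = inj₂ (inj₁ (trans (·⊝0· 1) (1· a)))
  D-code-sound 2F = inj₂ (inj₂ (inj₁ (trans (0·⊝· 1) (cong ⊖_ (1· a)))))
  D-code-sound 3F = inj₂ (inj₂ (inj₂ (inj₁ (·⊝0· 2))))
  D-code-sound 4F = inj₂ (inj₂ (inj₂ (inj₂ (0·⊝· 2))))

  D-code-complete : ∀ {d} → Dₐ a d → ∃[ δ ] D-code δ ≡ d
  D-code-complete (inj₁ refl) = 0F , ·⊝0· 0
  D-code-complete (inj₂ (inj₁ refl)) = 1F , trans (·⊝0· 1) (1· a)
  D-code-complete (inj₂ (inj₂ (inj₁ refl))) = 2F , trans (0·⊝· 1) (cong ⊖_ (1· a))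
  D-code-complete (inj₂ (inj₂ (inj₂ (inj₁ refl)))) = 3F , ·⊝0· 2
  D-code-complete (inj₂ (inj₂ (inj₂ (inj₂ refl)))) = 4F , 0·⊝· 2

-- Levels

module Residues (m' : ℕ) where

  open ZMod m' renaming (N to M)

  residue : ℤ → Fin M
  residue z = fromℕ< (n%ℕd<d z M)

  residue-≡ℤ : ∀ z → residue z ≡ℤ z
  residue-≡ℤ z = ℤ∣.∣⇒∣ᵤ (ℤ∣.divides (ℤ.- (z /ℕ M)) (begin
    + toℕ (residue z) ℤ.- z
      ≡⟨ cong (λ t → + t ℤ.- z) (toℕ-fromℕ< (n%ℕd<d z M)) ⟩
    + (z %ℕ M) ℤ.- z
      ≡⟨ cong (λ t → + (z %ℕ M) ℤ.- t) (a≡a%ℕn+[a/ℕn]*n z M) ⟩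
    + (z %ℕ M) ℤ.- (+ (z %ℕ M) ℤ.+ (z /ℕ M) ℤ.* + M)
      ≡⟨ x-[x+q*m]≡[-q]*m (+ (z %ℕ M)) (z /ℕ M) (+ M) ⟩
    (ℤ.- (z /ℕ M)) ℤ.* + M
      ∎))
    where
    open ≡-Reasoning
    x-[x+q*m]≡[-q]*m : ∀ x q m → x ℤ.- (x ℤ.+ q ℤ.* m) ≡ (ℤ.- q) ℤ.* m
    x-[x+q*m]≡[-q]*m = solve-∀

  ∣-below⇒≡0 : ∀ {x} → x < M → M ∣ℕ x → x ≡ 0
  ∣-below⇒≡0 {zero} _ _ = refl
  ∣-below⇒≡0 {suc x} x<M M∣x = ⊥-elim (>⇒∤ x<M M∣x)

  ≡ℤ-unique-ordered : ∀ {y y' : Fin M} {z} → toℕ y' ≤ toℕ y → y ≡ℤ z → y' ≡ℤ z → y ≡ y'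
  ≡ℤ-unique-ordered {y} {y'} {z} y'≤y y≡z y'≡z =
    toℕ-injective (≤-antisym (m∸n≡0⇒m≤n (∣-below⇒≡0 gap<M M∣gap)) y'≤y)
    where
    Y Y' : ℕ
    Y = toℕ y
    Y' = toℕ y'
    gap<M : Y ∸ Y' < M
    gap<M = ≤-<-trans (m∸n≤m Y Y') (toℕ<n y)
    [x-z]-[y-z]≡x-y : ∀ x y z → (x ℤ.- z) ℤ.- (y ℤ.- z) ≡ x ℤ.- y
    [x-z]-[y-z]≡x-y = solve-∀
    M∣gap : M ∣ℕ (Y ∸ Y')
    M∣gap = ℤ∣.∣⇒∣ᵤ (subst (+ M ℤ∣.∣_)
      (trans ([x-z]-[y-z]≡x-y (+ Y) (+ Y') z) (trans (ℤ.m-n≡m⊖n Y Y') (ℤ.⊖-≥ y'≤y)))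
      (ℤ∣.∣m∣n⇒∣m-n (ℤ∣.∣ᵤ⇒∣ {+ M} {+ Y ℤ.- z} y≡z) (ℤ∣.∣ᵤ⇒∣ {+ M} {+ Y' ℤ.- z} y'≡z)))

  ≡ℤ-unique : ∀ {y y' : Fin M} {z} → y ≡ℤ z → y' ≡ℤ z → y ≡ y'
  ≡ℤ-unique {y} {y'} {z} y≡z y'≡z with ≤-total (toℕ y') (toℕ y)
  ... | inj₁ y'≤y = ≡ℤ-unique-ordered {z = z} y'≤y y≡z y'≡z
  ... | inj₂ y≤y' = sym (≡ℤ-unique-ordered {z = z} y≤y' y'≡z y≡z)

  ≡ℤ-⊖ : ∀ {y : Fin M} {z} → y ≡ℤ z → (⊖ y) ≡ℤ (ℤ.- z)
  ≡ℤ-⊖ {y} {z} y≡z = ℤ∣.∣⇒∣ᵤ (subst (+ M ℤ∣.∣_) ([t+y]-[y-z]≡t-[-z] (+ T) (+ Y) z)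
    (ℤ∣.∣m∣n⇒∣m-n (subst (+ M ℤ∣.∣_) (ℤ.pos-+ T Y) (ℤ∣.∣ᵤ⇒∣ {+ M} {+ (T + Y)} M∣T+Y))
                  (ℤ∣.∣ᵤ⇒∣ {+ M} {+ Y ℤ.- z} y≡z)))
    where
    T Y : ℕ
    T = toℕ (⊖ y)
    Y = toℕ y
    [t+y]-[y-z]≡t-[-z] : ∀ t y z → (t ℤ.+ y) ℤ.- (y ℤ.- z) ≡ t ℤ.- (ℤ.- z)
    [t+y]-[y-z]≡t-[-z] = solve-∀
    M∣T+Y : M ∣ℕ (T + Y)
    M∣T+Y = m%n≡0⇒n∣m (T + Y) M (⟦⟧-≡⁻¹ (T + Y) 0 (AbelianGroup.inverseˡ ℤ/N y))

record Levelling (m : ℕ) (i : ℤ) : Set where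
  field
    level            : Fin m → Fin m
    level-injective  : Injective _≡_ _≡_ level
    level-surjective : ∀ (y : Fin m) → ∃[ j ] level j ≡ y
    level-step       : ∀ j → (level j ⊝ level (next j)) ≡ℤ (ℤ.- i)
    level-forward    : ∀ j j' → (level j ⊝ level j') ≡ℤ i → j ≡ next j'
    level-backward   : ∀ j j' → (level j ⊝ level j') ≡ℤ (ℤ.- i) → j' ≡ next j
    next²≢id         : ∀ (j : Fin m) → next (next j) ≢ j

module Levels (m' : ℕ) (m≥3 : 3 ≤ suc m') (i : ℤ) (i⊥m : gcd i (+ suc m') ≡ + 1) where

  open ZMod m' renaming (N to M)
  open Residues m'
  open import Algebra.Properties.AbelianGroup ℤ/N
    using (identityʳ-unique; ⁻¹-involutive; ⁻¹-anti-homo‿-)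
  open AbelianGroupDifferences ℤ/N
  open ≡-Reasoning

  ι : Fin M
  ι = residue i

  open Multiples ι using (OrderAbove; ·-injective-≤; ·-mod)

  M⊥ι : Coprime M (toℕ ι)
  M⊥ι {d} (d∣M , d∣ι) = gcd≡1⇒coprime (ℤ.+-injective i⊥m) (ℤ∣.∣⇒∣ᵤ d∣i , d∣M)
    where
    x-[x-y]≡y : ∀ x y → x ℤ.- (x ℤ.- y) ≡ y
    x-[x-y]≡y = solve-∀
    d∣i : + d ℤ∣.∣ i
    d∣i = subst (+ d ℤ∣.∣_) (x-[x-y]≡y (+ toℕ ι) i)
      (ℤ∣.∣m∣n⇒∣m-n (ℤ∣.∣ᵤ⇒∣ {+ d} {+ toℕ ι} d∣ι)
        (ℤ∣.∣-trans (ℤ∣.∣ᵤ⇒∣ {+ d} {+ M} d∣M) (ℤ∣.∣ᵤ⇒∣ {+ M} {+ toℕ ι ℤ.- i} (residue-≡ℤ i))))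

  ι-order : OrderAbove m'
  ι-order K K≤m' K·ι≡0 = ∣-below⇒≡0 (s≤s K≤m')
    (coprime-divisor M⊥ι (subst (M ∣ℕ_) (*-comm K (toℕ ι))
      (m%n≡0⇒n∣m (K * toℕ ι) M (⟦⟧-≡⁻¹ (K * toℕ ι) 0 K·ι≡0))))

  level : Fin M → Fin M
  level j = toℕ j · ι

  level-next : ∀ j → level (next j) ≡ level j ⊕ ι
  level-next j = begin
    toℕ (next j) · ι           ≡⟨ cong (_· ι) (toℕ-⟦⟧ (suc (toℕ j))) ⟩
    (suc (toℕ j) % M) · ι      ≡⟨ ·-mod M (N·≡zero ι) (suc (toℕ j)) ⟩
    (1 + toℕ j) · ι            ≡⟨ cong (_· ι) (+-comm 1 (toℕ j)) ⟩
    (toℕ j + 1) · ι            ≡⟨ ·-distribʳ-+ (toℕ j) 1 ι ⟩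
    level j ⊕ (1 · ι)          ≡⟨ cong (level j ⊕_) (1· ι) ⟩
    level j ⊕ ι                ∎

  level-injective : Injective _≡_ _≡_ level
  level-injective {j} {j'} e =
    toℕ-injective (·-injective-≤ ι-order (toℕ≤pred[n] j) (toℕ≤pred[n] j') e)

  level-surjective : ∀ y → ∃[ j ] level j ≡ y
  level-surjective = injective⇒surjective level-injective

  ⊖ι≡ℤ-i : (⊖ ι) ≡ℤ (ℤ.- i)
  ⊖ι≡ℤ-i = ≡ℤ-⊖ {ι} {i} (residue-≡ℤ i)

  level-step : ∀ j → (level j ⊝ level (next j)) ≡ℤ (ℤ.- i)
  level-step j = subst (_≡ℤ (ℤ.- i))
    (sym (trans (cong (level j ⊝_) (level-next j)) (x-[x∙y]≈y⁻¹ (level j) ι))) ⊖ι≡ℤ-i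

  level-gap-ι : ∀ j j' → level j ⊝ level j' ≡ ι → j ≡ next j'
  level-gap-ι j j' gap =
    level-injective (trans (x-y≈z⇒x≈y∙z (level j) (level j') ι gap) (sym (level-next j')))

  level-forward : ∀ j j' → (level j ⊝ level j') ≡ℤ i → j ≡ next j'
  level-forward j j' d = level-gap-ι j j' (≡ℤ-unique {level j ⊝ level j'} {ι} {i} d (residue-≡ℤ i))

  level-backward : ∀ j j' → (level j ⊝ level j') ≡ℤ (ℤ.- i) → j' ≡ next j
  level-backward j j' d = level-gap-ι j' j (begin
    level j' ⊝ level j        ≡⟨ ⁻¹-anti-homo‿- (level j) (level j') ⟨
    ⊖ (level j ⊝ level j')    ≡⟨ cong ⊖_ (≡ℤ-unique {level j ⊝ level j'} {⊖ ι} {ℤ.- i} d ⊖ι≡ℤ-i) ⟩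
    ⊖ (⊖ ι)                   ≡⟨ ⁻¹-involutive ι ⟩
    ι                         ∎)

  next²≢id : ∀ j → next (next j) ≢ j
  next²≢id j e = 2≢0 (ι-order 2 (≤-pred m≥3) (identityʳ-unique (level j) (2 · ι) (begin
    level j ⊕ (2 · ι)              ≡⟨ cong (level j ⊕_) (·-distribʳ-+ 1 1 ι) ⟩
    level j ⊕ ((1 · ι) ⊕ (1 · ι))  ≡⟨ cong (λ x → level j ⊕ (x ⊕ x)) (1· ι) ⟩
    level j ⊕ (ι ⊕ ι)              ≡⟨ ⊕-assoc (level j) ι ι ⟨
    (level j ⊕ ι) ⊕ ι              ≡⟨ cong (_⊕ ι) (level-next j) ⟨
    level (next j) ⊕ ι             ≡⟨ level-next (next j) ⟨
    level (next (next j))          ≡⟨ cong level e ⟩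
    level j                        ∎)))
    where
    2≢0 : 2 ≢ 0
    2≢0 ()

  levelling : Levelling M i
  levelling = record
    { level = level
    ; level-injective = level-injective
    ; level-surjective = level-surjective
    ; level-step = level-step
    ; level-forward = level-forward
    ; level-backward = level-backward
    ; next²≢id = next²≢id
    }

-- Phases

data Phase : Set where
  first second even odd : Phase

data _⇝_ : Phase → Phase → Set where
  first⇝second : first ⇝ second
  second⇝even  : second ⇝ even
  even⇝odd     : even ⇝ odd
  odd⇝even     : odd ⇝ even
  even⇝first   : even ⇝ first

all-⇝? : {P : Phase → Phase → Set} → (∀ κ κ' → Dec (P κ κ')) → Dec (∀ {κ κ'} → κ ⇝ κ' → P κ κ')
all-⇝? P? = map′
  (λ (p₁ , p₂ , p₃ , p₄ , p₅) → λ
    { first⇝second → p₁ ; second⇝even → p₂ ; even⇝odd → p₃ ; odd⇝even → p₄ ; even⇝first → p₅ })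
  (λ p → p first⇝second , p second⇝even , p even⇝odd , p odd⇝even , p even⇝first)
  (P? first second ×-dec P? second even ×-dec P? even odd ×-dec P? odd even ×-dec P? even first)

all-Parity? : {P : Parity → Set} → (∀ b → Dec (P b)) → Dec (∀ b → P b)
all-Parity? P? = map′
  (λ (p₀ , p₁) → λ { 0ℙ → p₀ ; 1ℙ → p₁ })
  (λ p → p 0ℙ , p 1ℙ)
  (P? 0ℙ ×-dec P? 1ℙ)

phaseOfParity : Parity → Phase
phaseOfParity 0ℙ = even
phaseOfParity 1ℙ = odd

alternating : ℕ → Phase
alternating J = phaseOfParity (parity J)

alternating-⇝ : ∀ J → alternating J ⇝ alternating (suc J)
alternating-⇝ zero = even⇝odd
alternating-⇝ (suc zero) = odd⇝even
alternating-⇝ (suc (suc J)) = alternating-⇝ J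

phaseAt : Parity → ℕ → Phase
phaseAt 0ℙ J = alternating J
phaseAt 1ℙ zero = first
phaseAt 1ℙ (suc zero) = second
phaseAt 1ℙ (suc (suc J)) = alternating J

phaseAt-⇝ : ∀ p J → phaseAt p J ⇝ phaseAt p (suc J)
phaseAt-⇝ 0ℙ J = alternating-⇝ J
phaseAt-⇝ 1ℙ zero = first⇝second
phaseAt-⇝ 1ℙ (suc zero) = second⇝even
phaseAt-⇝ 1ℙ (suc (suc J)) = alternating-⇝ J

parity-pred : ∀ J {p} → parity (suc J) ≡ p → parity J ≡ p ℙ.⁻¹
parity-pred J eq = trans (sym (ℙ.suc-homo-⁻¹ J)) (cong ℙ._⁻¹ eq)

phaseAt-wrap : ∀ J → 2 ≤ J → phaseAt (parity (suc J)) J ⇝ phaseAt (parity (suc J)) 0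
phaseAt-wrap J _ with parity (suc J) in eq
... | 0ℙ rewrite parity-pred J eq = odd⇝even
phaseAt-wrap (suc (suc J)) _ | 1ℙ rewrite parity-pred J eq = even⇝first

module PhaseWalk (m' : ℕ) (m≥3 : 3 ≤ suc m') where

  open ZMod m' renaming (N to M)

  phase : Fin M → Phase
  phase j = phaseAt (parity M) (toℕ j)

  phase-⇝ : ∀ j → phase j ⇝ phase (next j)
  phase-⇝ j with suc (toℕ j) ℕ.<? M
  ... | yes j+1<M = subst (λ t → phase j ⇝ phaseAt (parity M) t)
      (sym (trans (toℕ-⟦⟧ (suc (toℕ j))) (m<n⇒m%n≡m j+1<M))) (phaseAt-⇝ (parity M) (toℕ j))
  ... | no j+1≮M = subst₂ (λ s t → phaseAt (parity M) s ⇝ phaseAt (parity M) t)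
      (sym j≡m') (sym next-j≡0) (phaseAt-wrap m' (≤-pred m≥3))
    where
    j≡m' : toℕ j ≡ m'
    j≡m' = ≤-antisym (≤-pred (toℕ<n j)) (≤-pred (≮⇒≥ j+1≮M))
    next-j≡0 : toℕ (next j) ≡ 0
    next-j≡0 = trans (toℕ-⟦⟧ (suc (toℕ j))) (trans (cong (λ t → suc t % M) j≡m') (n%n≡0 M))

-- Factorizations from cycle systems

module CycleFactorization
  {k m : ℕ} (a : Fin (suc k)) {i : ℤ} (L : Levelling m i)
  {r : ℕ} (code : Fin r → Fin (suc k))
  (code-injective : Injective _≡_ _≡_ code)
  (code-complete : ∀ {d} → Dₐ a d → ∃[ δ ] code δ ≡ d)
  (pos : Fin r → Fin (suc k) → Fin m → Fin (suc k))
  (start : Fin r → Fin m → Fin (suc k) → Fin (suc k))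
  (pos-start : ∀ f j x → pos f (start f j x) j ≡ x)
  (start-pos : ∀ f j c → start f j (pos f c j) ≡ c)
  (pos-step : ∀ f c j → Dₐ a (pos f c j ⊝ pos f c (next j)))
  (successor-covers : ∀ j x δ → ∃[ f ] pos f (start f j x) (next j) ≡ x ⊕ code δ)
  where

  open Levelling L
  open ZMod k using (ℤ/N)
  open import Algebra.Properties.AbelianGroup ℤ/N using (∙-cancelˡ)
  open AbelianGroupDifferences ℤ/N using (x∙[y-x]≈y)
  open Multiples a using (Dₐ-⊝-swap)

  V : Set
  V = Vertex (suc k) m

  Adj : V → V → Set
  Adj = CayAdj (Sₐᵢ a i)

  vertex : Fin r → Fin (suc k) → Fin m → V
  vertex f c j = pos f c j , level j

  factor : Fin r → CFactor V Adj m
  factor f = record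
    { k        = suc k
    ; cyc      = vertex f
    ; cyc-inj  = λ c e → level-injective (cong proj₂ e)
    ; cyc-adj  = λ c j → pos-step f c j , inj₂ (level-step j)
    ; covers   = λ (x , y) → let (j , level-j≡y) = level-surjective y in
                   start f j x , j , cong₂ _,_ (pos-start f j x) level-j≡y
    ; disjoint = disjoint
    }
    where
    disjoint : ∀ c c' j j' → vertex f c j ≡ vertex f c' j' → c ≡ c'
    disjoint c c' j j' e with level-injective (cong proj₂ e)
    ... | refl = trans (sym (start-pos f j c))
                       (trans (cong (start f j) (cong proj₁ e)) (start-pos f j c'))

  successor : Fin r → Fin m → Fin (suc k) → Fin (suc k)
  successor f j x = pos f (start f j x) (next j)

  successor-pos : ∀ f c j → successor f j (pos f c j) ≡ pos f c (next j)
  successor-pos f c j = cong (λ c → pos f c (next j)) (start-pos f j c)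

  -- Pigeonhole: the r factors realise the r differences code δ, each exactly once.
  successor-injective : ∀ j x → Injective _≡_ _≡_ (λ f → successor f j x)
  successor-injective j x = covering⇒injective (λ f → successor f j x) (λ δ → x ⊕ code δ)
    (λ e → code-injective (∙-cancelˡ x _ _ e)) (successor-covers j x)

  successor-⊝ : ∀ j x x' → Dₐ a (x' ⊝ x) → ∃[ f ] successor f j x ≡ x'
  successor-⊝ j x x' d =
    let (δ , code-δ≡) = code-complete d
        (f , succ≡) = successor-covers j x δ
    in f , trans succ≡ (trans (cong (x ⊕_) code-δ≡) (x∙[y-x]≈y x x'))

  cover : ∀ u v → Adj u v → ∃[ f ] InFactor (factor f) u v
  cover (x , y) (x' , y') (d , step) with level-surjective y | level-surjective y'
  cover (x , _) (x' , _) (d , inj₁ forward) | j , refl | j' , refl with level-forward j j' forward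
  ... | refl = let (f , succ≡x) = successor-⊝ j' x' x d in
    f , start f j' x' , j' , inj₂ (cong₂ _,_ (pos-start f j' x') refl , cong₂ _,_ succ≡x refl)
  cover (x , _) (x' , _) (d , inj₂ backward) | j , refl | j' , refl with level-backward j j' backward
  ... | refl = let (f , succ≡x') = successor-⊝ j x x' (Dₐ-⊝-swap x x' d) in
    f , start f j x , j , inj₁ (cong₂ _,_ (pos-start f j x) refl , cong₂ _,_ succ≡x' refl)

  same-orientation : ∀ {f f' c c' j j'} → vertex f c j ≡ vertex f' c' j' →
                     vertex f c (next j) ≡ vertex f' c' (next j') → f ≡ f'
  same-orientation {f} {f'} {c} {c'} {j} {j'} e e-next with level-injective (cong proj₂ e)
  ... | refl = successor-injective j (pos f c j) (begin
    successor f j (pos f c j)     ≡⟨ successor-pos f c j ⟩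
    pos f c (next j)              ≡⟨ cong proj₁ e-next ⟩
    pos f' c' (next j)            ≡⟨ successor-pos f' c' j ⟨
    successor f' j (pos f' c' j)  ≡⟨ cong (successor f' j) (cong proj₁ e) ⟨
    successor f' j (pos f c j)    ∎)
    where open ≡-Reasoning

  opposite-orientation : ∀ {f f' c c' j j'} → vertex f c j ≡ vertex f' c' (next j') →
                         vertex f c (next j) ≡ vertex f' c' j' → ⊥
  opposite-orientation {j = j} {j'} e e-next with level-injective (cong proj₂ e)
  ... | refl = next²≢id j' (level-injective (cong proj₂ e-next))

  unique : ∀ u v → Adj u v → ∀ f f' → InFactor (factor f) u v → InFactor (factor f') u v → f ≡ f'
  unique _ _ _ _ _ (_ , _ , inj₁ (e₁ , e₂)) (_ , _ , inj₁ (e₁' , e₂')) =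
    same-orientation (trans e₁ (sym e₁')) (trans e₂ (sym e₂'))
  unique _ _ _ _ _ (_ , _ , inj₂ (e₁ , e₂)) (_ , _ , inj₂ (e₁' , e₂')) =
    same-orientation (trans e₁ (sym e₁')) (trans e₂ (sym e₂'))
  unique _ _ _ _ _ (_ , _ , inj₁ (e₁ , e₂)) (_ , _ , inj₂ (e₁' , e₂')) =
    ⊥-elim (opposite-orientation (trans e₁ (sym e₂')) (trans e₂ (sym e₁')))
  unique _ _ _ _ _ (_ , _ , inj₂ (e₁ , e₂)) (_ , _ , inj₁ (e₁' , e₂')) =
    ⊥-elim (opposite-orientation (trans e₁ (sym e₂')) (trans e₂ (sym e₁')))

  factorization : CFactorization V Adj m
  factorization = record { r = r ; factor = factor ; cover = cover ; unique = unique }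

-- Cycle systems from offset tables

-- _~_ is a decidable relation on exponents that forces equal multiples of a, so conditions on
-- offset tables stated with it can be decided by evaluation.
record DifferenceCode {k : ℕ} (a : Fin (suc k)) (r : ℕ) : Set₁ where
  field
    _~_        : ℕ → ℕ → Set
    _~?_       : ∀ u v → Dec (u ~ v)
    ~⇒·≡       : ∀ {u v} → u ~ v → u · a ≡ v · a
    plus minus : Fin r → ℕ

  code : Fin r → Fin (suc k)
  code δ = (plus δ · a) ⊝ (minus δ · a)

  field
    code-injective : Injective _≡_ _≡_ code
    code-sound     : ∀ δ → Dₐ a (code δ)
    code-complete  : ∀ {d} → Dₐ a d → ∃[ δ ] code δ ≡ d

  ·⊝·≡code : ∀ {s t} δ → (s + minus δ) ~ (plus δ + t) → (s · a) ⊝ (t · a) ≡ code δ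
  ·⊝·≡code {s} {t} δ s~t = Multiples.·-difference a s t (plus δ) (minus δ) (~⇒·≡ s~t)

[p+t]+t≡p : ∀ p t → (p ℙ.+ t) ℙ.+ t ≡ p
[p+t]+t≡p p t = begin
  (p ℙ.+ t) ℙ.+ t  ≡⟨ ℙ.+-assoc p t t ⟩
  p ℙ.+ (t ℙ.+ t)  ≡⟨ cong (p ℙ.+_) (ℙ.p+p≡0ℙ t) ⟩
  p ℙ.+ 0ℙ         ≡⟨ ℙ.+-identityʳ p ⟩
  p                ∎
  where open ≡-Reasoning

module OffsetChecks {k r : ℕ} {a : Fin (suc k)} (D : DifferenceCode a r)
  (offset : Fin r → Phase → Parity → ℕ) (twist : Fin r → Phase → Parity) where

  open DifferenceCode D

  Steps : Phase → Phase → Set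
  Steps κ κ' = ∀ f b → ∃[ δ ] (offset f κ b + minus δ) ~ (plus δ + offset f κ' b)

  steps? : ∀ κ κ' → Dec (Steps κ κ')
  steps? κ κ' = all? λ f → all-Parity? λ b → any? λ δ →
    (offset f κ b + minus δ) ~? (plus δ + offset f κ' b)

  Covers : Phase → Phase → Set
  Covers κ κ' = ∀ b δ → ∃[ f ]
    (offset f κ' (b ℙ.+ twist f κ) + minus δ) ~ (plus δ + offset f κ (b ℙ.+ twist f κ))

  covers? : ∀ κ κ' → Dec (Covers κ κ')
  covers? κ κ' = all-Parity? λ b → all? λ δ → any? λ f →
    (offset f κ' (b ℙ.+ twist f κ) + minus δ) ~? (plus δ + offset f κ (b ℙ.+ twist f κ))

module OffsetFactorization
  {k m' : ℕ} (m≥3 : 3 ≤ suc m') (a : Fin (suc k)) (i : ℤ) (i⊥m : gcd i (+ suc m') ≡ + 1)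
  {r : ℕ} (D : DifferenceCode a r)
  (offset : Fin r → Phase → Parity → ℕ)
  (colour : Fin (suc k) → Parity) (twist : Fin r → Phase → Parity)
  (colour-shift : ∀ f κ b c → colour (c ⊕ (offset f κ b · a)) ≡ colour c ℙ.+ twist f κ)
  (steps : ∀ {κ κ'} → κ ⇝ κ' → OffsetChecks.Steps D offset twist κ κ')
  (covers : ∀ {κ κ'} → κ ⇝ κ' → OffsetChecks.Covers D offset twist κ κ')
  where

  open DifferenceCode D
  open PhaseWalk m' m≥3
  open ZMod k using (ℤ/N)
  open import Algebra.Properties.AbelianGroup ℤ/N using (//-rightDividesˡ; //-rightDividesʳ)
  open AbelianGroupDifferences ℤ/N using (x∙y-x∙z≈y-z; [x-y]∙z≈x∙[z-y])
  open ≡-Reasoning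

  shift : Fin r → Phase → Parity → Fin (suc k)
  shift f κ b = offset f κ b · a

  pos : Fin r → Fin (suc k) → Fin (suc m') → Fin (suc k)
  pos f c j = c ⊕ shift f (phase j) (colour c)

  entry-colour : Fin r → Fin (suc m') → Fin (suc k) → Parity
  entry-colour f j x = colour x ℙ.+ twist f (phase j)

  start : Fin r → Fin (suc m') → Fin (suc k) → Fin (suc k)
  start f j x = x ⊝ shift f (phase j) (entry-colour f j x)

  colour-start : ∀ f j x → colour (start f j x) ≡ entry-colour f j x
  colour-start f j x = begin
    colour s                               ≡⟨ [p+t]+t≡p (colour s) t ⟨
    (colour s ℙ.+ t) ℙ.+ t                 ≡⟨ cong (ℙ._+ t) (colour-shift f (phase j) b s) ⟨
    colour (s ⊕ shift f (phase j) b) ℙ.+ t ≡⟨ cong (λ y → colour y ℙ.+ t) (//-rightDividesˡ _ x) ⟩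
    colour x ℙ.+ t                         ∎
    where
    s : Fin (suc k)
    s = start f j x
    t b : Parity
    t = twist f (phase j)
    b = entry-colour f j x

  pos-start : ∀ f j x → pos f (start f j x) j ≡ x
  pos-start f j x = trans (cong (λ b → start f j x ⊕ shift f (phase j) b) (colour-start f j x))
                          (//-rightDividesˡ _ x)

  start-pos : ∀ f j c → start f j (pos f c j) ≡ c
  start-pos f j c = trans (cong (λ b → pos f c j ⊝ shift f (phase j) b) entry≡)
                          (//-rightDividesʳ _ c)
    where
    entry≡ : entry-colour f j (pos f c j) ≡ colour c
    entry≡ = trans (cong (ℙ._+ twist f (phase j)) (colour-shift f (phase j) (colour c) c))
                   ([p+t]+t≡p (colour c) (twist f (phase j)))

  pos-step : ∀ f c j → Dₐ a (pos f c j ⊝ pos f c (next j))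
  pos-step f c j = let (δ , s~t) = steps (phase-⇝ j) f (colour c) in
    subst (Dₐ a) (sym (trans (x∙y-x∙z≈y-z c _ _) (·⊝·≡code δ s~t))) (code-sound δ)

  successor-covers : ∀ j x δ → ∃[ f ] pos f (start f j x) (next j) ≡ x ⊕ code δ
  successor-covers j x δ = let (f , s~t) = covers (phase-⇝ j) (colour x) δ in f , (begin
    start f j x ⊕ shift f (phase (next j)) (colour (start f j x))
      ≡⟨ cong (λ b → start f j x ⊕ shift f (phase (next j)) b) (colour-start f j x) ⟩
    (x ⊝ here f) ⊕ there f  ≡⟨ [x-y]∙z≈x∙[z-y] x (here f) (there f) ⟩
    x ⊕ (there f ⊝ here f)  ≡⟨ cong (x ⊕_) (·⊝·≡code δ s~t) ⟩
    x ⊕ code δ              ∎)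
    where
    here there : Fin r → Fin (suc k)
    here f = shift f (phase j) (entry-colour f j x)
    there f = shift f (phase (next j)) (entry-colour f j x)

  factorization : CFactorization (Vertex (suc k) (suc m')) (CayAdj (Sₐᵢ a i)) (suc m')
  factorization = CycleFactorization.factorization a (Levels.levelling m' m≥3 i i⊥m)
    code code-injective code-complete pos start pos-start start-pos pos-step successor-covers

-- The two cases

module QuarterColouring {k : ℕ} (a : Fin (suc k)) (order : Multiples.OrderAbove a 3)
  (4·a≡0 : 4 · a ≡ Fin.zero) where

  open ZMod k
  open ≡-Reasoning

  A : ℕ
  A = toℕ a

  colour : Fin N → Parity
  colour x = parity ((4 * toℕ x) / N)

  q : ℕ
  q = (4 * A) / N

  4A≡qN : 4 * A ≡ q * N
  4A≡qN = trans (m≡m%n+[m/n]*n (4 * A) N) (cong (_+ q * N) (⟦⟧-≡⁻¹ (4 * A) 0 4·a≡0))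

  q<4 : q < 4
  q<4 = m<n*o⇒m/o<n (*-monoʳ-< 4 (toℕ<n a))

  q-odd : parity q ≡ 1ℙ
  q-odd with q | 4A≡qN | q<4
  ... | 0 | 4A≡0 | _ = ⊥-elim (1≢0 (order 1 (s≤s z≤n) (trans (1· a) (toℕ-injective A≡0))))
    where
    A≡0 : A ≡ 0
    A≡0 = *-cancelˡ-≡ A 0 4 4A≡0
    1≢0 : 1 ≢ 0
    1≢0 ()
  ... | 1 | _ | _ = refl
  ... | 2 | 4A≡2N | _ =
    ⊥-elim (2≢0 (order 2 (s≤s (s≤s z≤n)) (trans (cong ⟦_⟧ 2A≡N) (⟦⟧-≡ N 0 (n%n≡0 N)))))
    where
    2A≡N : 2 * A ≡ N
    2A≡N = *-cancelˡ-≡ (2 * A) N 2 (trans (sym (*-assoc 2 2 A)) 4A≡2N)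
    2≢0 : 2 ≢ 0
    2≢0 ()
  ... | 3 | _ | _ = refl
  ... | suc (suc (suc (suc _))) | _ | s≤s (s≤s (s≤s (s≤s ())))

  parity-+4* : ∀ u e → parity (u + 4 * e) ≡ parity u
  parity-+4* u e = begin
    parity (u + 4 * e)           ≡⟨ ℙ.+-homo-+ u (4 * e) ⟩
    parity u ℙ.+ parity (4 * e)  ≡⟨ cong (parity u ℙ.+_) (ℙ.*-homo-* 4 e) ⟩
    parity u ℙ.+ 0ℙ              ≡⟨ ℙ.+-identityʳ (parity u) ⟩
    parity u                     ∎

  /N-+*N : ∀ u c → (u + c * N) / N ≡ u / N + c
  /N-+*N u c = trans (+-distrib-/-∣ʳ u (divides c refl)) (cong (λ t → u / N + t) (m*n/n≡m c N))

  colour-⊕a : ∀ x → colour (x ⊕ a) ≡ colour x ℙ.+ 1ℙ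
  colour-⊕a x = begin
    parity ((4 * toℕ (x ⊕ a)) / N)  ≡⟨ cong (λ t → parity ((4 * t) / N)) (toℕ-⟦⟧ (X + A)) ⟩
    parity ((4 * Y) / N)            ≡⟨ parity-+4* ((4 * Y) / N) e ⟨
    parity ((4 * Y) / N + 4 * e)    ≡⟨ cong parity quotients ⟩
    parity ((4 * X) / N + q)        ≡⟨ ℙ.+-homo-+ ((4 * X) / N) q ⟩
    colour x ℙ.+ parity q           ≡⟨ cong (colour x ℙ.+_) q-odd ⟩
    colour x ℙ.+ 1ℙ                 ∎
    where
    X Y e : ℕ
    X = toℕ x
    Y = (X + A) % N
    e = (X + A) / N
    scaled : 4 * X + q * N ≡ 4 * Y + (4 * e) * N
    scaled = begin
      4 * X + q * N        ≡⟨ cong (λ t → 4 * X + t) 4A≡qN ⟨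
      4 * X + 4 * A        ≡⟨ *-distribˡ-+ 4 X A ⟨
      4 * (X + A)          ≡⟨ cong (4 *_) (m≡m%n+[m/n]*n (X + A) N) ⟩
      4 * (Y + e * N)      ≡⟨ *-distribˡ-+ 4 Y (e * N) ⟩
      4 * Y + 4 * (e * N)  ≡⟨ cong (λ t → 4 * Y + t) (*-assoc 4 e N) ⟨
      4 * Y + (4 * e) * N  ∎
    quotients : (4 * Y) / N + 4 * e ≡ (4 * X) / N + q
    quotients = trans (sym (/N-+*N (4 * Y) (4 * e)))
                      (trans (cong (_/ N) (sym scaled)) (/N-+*N (4 * X) q))

  colour-shift : ∀ c t → colour (c ⊕ (t · a)) ≡ colour c ℙ.+ parity t
  colour-shift c zero = trans (cong colour (⊕-identityʳ c)) (sym (ℙ.+-identityʳ (colour c)))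
  colour-shift c (suc t) = begin
    colour (c ⊕ ((1 + t) · a))      ≡⟨ cong colour shift-step ⟩
    colour ((c ⊕ (t · a)) ⊕ a)      ≡⟨ colour-⊕a (c ⊕ (t · a)) ⟩
    colour (c ⊕ (t · a)) ℙ.+ 1ℙ     ≡⟨ cong (ℙ._+ 1ℙ) (colour-shift c t) ⟩
    (colour c ℙ.+ parity t) ℙ.+ 1ℙ  ≡⟨ ℙ.+-assoc (colour c) (parity t) 1ℙ ⟩
    colour c ℙ.+ (parity t ℙ.+ 1ℙ)  ≡⟨ cong (colour c ℙ.+_) (ℙ.+-comm (parity t) 1ℙ) ⟩
    colour c ℙ.+ (1ℙ ℙ.+ parity t)  ≡⟨ cong (colour c ℙ.+_) (ℙ.+-homo-+ 1 t) ⟨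
    colour c ℙ.+ parity (suc t)     ∎
    where
    shift-step : c ⊕ ((1 + t) · a) ≡ (c ⊕ (t · a)) ⊕ a
    shift-step = begin
      c ⊕ ((1 + t) · a)        ≡⟨ cong (c ⊕_) (·-distribʳ-+ 1 t a) ⟩
      c ⊕ ((1 · a) ⊕ (t · a))  ≡⟨ cong (λ y → c ⊕ (y ⊕ (t · a))) (1· a) ⟩
      c ⊕ (a ⊕ (t · a))        ≡⟨ cong (c ⊕_) (⊕-comm a (t · a)) ⟩
      c ⊕ ((t · a) ⊕ a)        ≡⟨ ⊕-assoc c (t · a) a ⟨
      (c ⊕ (t · a)) ⊕ a        ∎

module OrderAboveFour
  {k m' : ℕ} (m≥3 : 3 ≤ suc m') (a : Fin (suc k)) (order : Multiples.OrderAbove a 4)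
  (i : ℤ) (i⊥m : gcd i (+ suc m') ≡ + 1) where

  open Multiples a

  D-sum≤4 : ∀ δ δ' → D-plus δ + D-minus δ' ≤ 4
  D-sum≤4 = from-yes (all? λ δ → all? λ δ' → D-plus δ + D-minus δ' ℕ.≤? 4)

  D-sums-separate : ∀ δ δ' → D-plus δ + D-minus δ' ≡ D-plus δ' + D-minus δ → δ ≡ δ'
  D-sums-separate = from-yes (all? λ δ → all? λ δ' →
    (D-plus δ + D-minus δ' ≟ D-plus δ' + D-minus δ) →-dec (δ Fin.≟ δ'))

  codes : DifferenceCode a 5
  codes = record
    { _~_ = _≡_
    ; _~?_ = _≟_
    ; ~⇒·≡ = cong (_· a)
    ; plus = D-plus
    ; minus = D-minus
    ; code-injective = λ {δ} {δ'} e → D-sums-separate δ δ'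
        (·-injective-≤ order (D-sum≤4 δ δ') (D-sum≤4 δ' δ)
          (·-difference⁻¹ (D-plus δ) (D-minus δ) (D-plus δ') (D-minus δ') e))
    ; code-sound = D-code-sound
    ; code-complete = D-code-complete
    }

  offset : Fin 5 → Phase → Parity → ℕ
  offset f first  _ = toℕ f
  offset f second _ = lookup (2 ∷ 0 ∷ 3 ∷ 1 ∷ 4 ∷ []) f
  offset f even   _ = 2
  offset f odd    _ = toℕ f

  open OffsetChecks codes offset (λ _ _ → 0ℙ)

  factorization : CFactorization (Vertex (suc k) (suc m')) (CayAdj (Sₐᵢ a i)) (suc m')
  factorization = OffsetFactorization.factorization m≥3 a i i⊥m codes offset
    (λ _ → 0ℙ) (λ _ _ → 0ℙ) (λ _ _ _ _ → refl)
    (from-yes (all-⇝? steps?)) (from-yes (all-⇝? covers?))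

module OrderFour
  {k m' : ℕ} (m≥3 : 3 ≤ suc m') (a : Fin (suc k)) (order : Multiples.OrderAbove a 3)
  (4·a≡0 : 4 · a ≡ Fin.zero) (i : ℤ) (i⊥m : gcd i (+ suc m') ≡ + 1) where

  open Multiples a
  open QuarterColouring a order 4·a≡0 using (colour; colour-shift)

  plus minus : Fin 4 → ℕ
  plus δ = D-plus (Fin.inject₁ δ)
  minus δ = D-minus (Fin.inject₁ δ)

  _≡₄_ : ℕ → ℕ → Set
  u ≡₄ v = u % 4 ≡ v % 4

  ≡₄⇒·≡ : ∀ u v → u ≡₄ v → u · a ≡ v · a
  ≡₄⇒·≡ u v e = trans (sym (·-mod 4 4·a≡0 u)) (trans (cong (_· a) e) (·-mod 4 4·a≡0 v))

  ·≡⇒≡₄ : ∀ u v → u · a ≡ v · a → u ≡₄ v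
  ·≡⇒≡₄ u v e = ·-injective-≤ order (≤-pred (m%n<n u 4)) (≤-pred (m%n<n v 4))
    (trans (·-mod 4 4·a≡0 u) (trans e (sym (·-mod 4 4·a≡0 v))))

  D-sums-separate : ∀ δ δ' → (plus δ + minus δ') ≡₄ (plus δ' + minus δ) → δ ≡ δ'
  D-sums-separate = from-yes (all? λ δ → all? λ δ' →
    ((plus δ + minus δ') % 4 ≟ (plus δ' + minus δ) % 4) →-dec (δ Fin.≟ δ'))

  codes : DifferenceCode a 4
  codes = record
    { _~_ = _≡₄_
    ; _~?_ = λ u v → u % 4 ≟ v % 4
    ; ~⇒·≡ = λ {u} {v} → ≡₄⇒·≡ u v
    ; plus = plus
    ; minus = minus
    ; code-injective = λ {δ} {δ'} e → D-sums-separate δ δ'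
        (·≡⇒≡₄ (plus δ + minus δ') (plus δ' + minus δ)
          (·-difference⁻¹ (plus δ) (minus δ) (plus δ') (minus δ') e))
    ; code-sound = λ δ → D-code-sound (Fin.inject₁ δ)
    ; code-complete = code-complete
    }
    where
    code-complete : ∀ {d} → Dₐ a d → ∃[ δ ] (plus δ · a) ⊝ (minus δ · a) ≡ d
    code-complete d with D-code-complete d
    ... | 0F , e = 0F , e
    ... | 1F , e = 1F , e
    ... | 2F , e = 2F , e
    ... | 3F , e = 3F , e
    ... | 4F , e = 3F , trans (·-difference 2 0 0 2 (≡₄⇒·≡ 4 0 refl)) e

  base : Fin 4 → Phase → ℕ
  base f first  = 0
  base f second = toℕ f
  base f even   = lookup (0 ∷ 2 ∷ 3 ∷ 1 ∷ []) f
  base f odd    = 0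

  offset : Fin 4 → Phase → Parity → ℕ
  offset f κ 0ℙ = base f κ
  offset f κ 1ℙ = (4 ∸ base f κ) % 4

  twist : Fin 4 → Phase → Parity
  twist f κ = parity (base f κ)

  offset-parity : ∀ f κ b → parity (offset f κ b) ≡ twist f κ
  offset-parity f κ      0ℙ = refl
  offset-parity f first  1ℙ = refl
  offset-parity f odd    1ℙ = refl
  offset-parity f second 1ℙ = from-yes (all? λ f → parity (offset f second 1ℙ) ℙ.≟ twist f second) f
  offset-parity f even   1ℙ = from-yes (all? λ f → parity (offset f even 1ℙ) ℙ.≟ twist f even) f

  open OffsetChecks codes offset twist

  factorization : CFactorization (Vertex (suc k) (suc m')) (CayAdj (Sₐᵢ a i)) (suc m')
  factorization = OffsetFactorization.factorization m≥3 a i i⊥m codes offset colour twist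
    (λ f κ b c → trans (colour-shift c (offset f κ b)) (cong (colour c ℙ.+_) (offset-parity f κ b)))
    (from-yes (all-⇝? steps?)) (from-yes (all-⇝? covers?))

OrderGT3⇒OrderAbove3 : ∀ {k} {a : Fin (suc k)} → OrderGT3 a → Multiples.OrderAbove a 3
OrderGT3⇒OrderAbove3 {a = a} (1·a≢0 , 2·a≢0 , 3·a≢0) =
  OrderAbove-suc (OrderAbove-suc (OrderAbove-suc order>0 1·a≢0) 2·a≢0) 3·a≢0
  where
  open Multiples a
  order>0 : OrderAbove 0
  order>0 K K≤0 _ = n≤0⇒n≡0 K≤0

lemma2p1 : (n m : ℕ) → n ≥ 3 → m ≥ 3 →
           (a : Fin n) → OrderGT3 {n} a → (i : ℤ) → gcd i (+ m) ≡ + 1 →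
           CFactorization (Vertex n m)
             (CayAdj (Sₐᵢ a i)) m
lemma2p1 (suc k) (suc m') _ m≥3 a order>3 i i⊥m with 4 · a Fin.≟ Fin.zero
... | no 4·a≢0 = OrderAboveFour.factorization m≥3 a
      (Multiples.OrderAbove-suc a (OrderGT3⇒OrderAbove3 order>3) 4·a≢0) i i⊥m
... | yes 4·a≡0 = OrderFour.factorization m≥3 a (OrderGT3⇒OrderAbove3 order>3) 4·a≡0 i i⊥m
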